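{- Let $q\in\mathbb{C}$ with $q\neq1$ be such that $[n]_q\neq 0$ for all $n\geq 1$, let $u,\alpha\in\mathbb{C}$, let $(a_n^{(\alpha)})_{n\ge0}$ be complex numbers with $a_0^{(\alpha)}\neq0$ and $\mathcal{A}_q^{\alpha}(t)=\sum_{n\ge0}a_n^{(\alpha)}\frac{t^n}{[n]_q!}$, and let $\mathrm{P}_{n,q}^{(\alpha)}(x;u)$ be defined by $\mathcal{A}_q^{\alpha}(t)\mathrm{e}_q(tx,u)=\sum_{n}\mathrm{P}_{n,q}^{(\alpha)}(x;u)\frac{t^n}{[n]_q!}$. Define $\mathrm{Q}_{n,q}^{(\alpha)}(x,y,z;u)=\sum_{k=0}^{n}\genfrac{[}{]}{0pt}{}{n}{k}_{q}\mathrm{P}_{k,q}^{(\alpha)}(x;u)y^kz^{n-k}$. Then, as formal power series in $t$, $$\sum_{n=0}^{\infty}q^{\binom{n}{2}}\mathrm{Q}_{n,q}^{(\alpha)}(x,y,z;u)\frac{t^n}{[n]_q!}=\mathrm{E}_q(zt)\sum_{k=0}^{\infty}q^{\binom{k}{2}}\frac{\mathrm{P}_{k,q}^{(\alpha)}(x;u)}{(-(1-q)zt;q)_k\,[k]_q!}(ty)^k.$$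
   Context: $[n]_q=\frac{1-q^n}{1-q}$, $[n]_q!=[1]_q\cdots[n]_q$ ($[0]_q!=1$), $\genfrac{[}{]}{0pt}{}{n}{k}_{q}=\frac{[n]_q!}{[k]_q![n-k]_q!}$. $\mathrm{e}_q(z,u)=\sum_{n\ge0}u^{\binom{n}{2}}\frac{z^n}{[n]_q!}$ (convention $0^0=1$), and $\mathrm{E}_q(z)=\mathrm{e}_q(z,q)=\sum_{n\ge0}q^{\binom{n}{2}}\frac{z^n}{[n]_q!}$. The $q$-shifted factorial is $(a;q)_0=1$, $(a;q)_k=\prod_{j=0}^{k-1}(1-q^ja)$. -}

module Defs where

open import Level using (Level)
open import Data.Nat as ℕ using (ℕ; zero; suc; _∸_; _≤ᵇ_)
open import Data.Nat.Combinatorics using (_C_)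
open import Data.Bool using (if_then_else_; _∧_)
open import Algebra.Bundles using (CommutativeRing; Semiring)

-- All definitions are over a commutative ring R together with a total
-- function inv : R → R (used as the multiplicative inverse of a field;
-- the field axioms are hypotheses of the theorem).
module Series {c ℓ : Level} (R : CommutativeRing c ℓ)
              (inv : CommutativeRing.Carrier R → CommutativeRing.Carrier R) where

  open CommutativeRing R
  open import Algebra.Definitions.RawSemiring (Semiring.rawSemiring semiring) using (_^_)

  FPS : Set c
  FPS = ℕ → Carrier

  Σ≤ : ℕ → (ℕ → Carrier) → Carrier
  Σ≤ zero    f = f 0
  Σ≤ (suc n) f = Σ≤ n f + f (suc n)

  Σ< : ℕ → (ℕ → Carrier) → Carrier
  Σ< zero    f = 0#
  Σ< (suc n) f = Σ< n f + f n

  Π< : ℕ → (ℕ → Carrier) → Carrier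
  Π< zero    f = 1#
  Π< (suc n) f = Π< n f * f n

  qint : Carrier → ℕ → Carrier
  qint q n = (1# - q ^ n) * inv (1# - q)

  qfact : Carrier → ℕ → Carrier
  qfact q n = Π< n (λ j → qint q (suc j))

  qbinom : Carrier → ℕ → ℕ → Carrier
  qbinom q n k = qfact q n * inv (qfact q k * qfact q (n ∸ k))

  _⊛_ : FPS → FPS → FPS
  (f ⊛ g) n = Σ≤ n (λ k → f k * g (n ∸ k))

  monomial : Carrier → ℕ → FPS
  monomial a k m = if (k ≤ᵇ m) ∧ (m ≤ᵇ k) then a else 0#

  -- multiplicative inverse of a formal power series f (constant term invertible):
  -- b_0 = f_0⁻¹,  b_{n+1} = - f_0⁻¹ Σ_{i=1}^{n+1} f_i b_{n+1-i}
  approx : FPS → ℕ → FPS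
  approx f zero    = λ _ → inv (f 0)
  approx f (suc n) = λ m → if m ≤ᵇ n then approx f n m
                            else - (inv (f 0) * Σ< (suc n) (λ i → f (suc i) * approx f n (n ∸ i)))

  invFPS : FPS → FPS
  invFPS f m = approx f m m

  -- e_q(z t, u) as a series in t : coefficients u^{binom n 2} z^n / [n]_q!
  eqSer : Carrier → Carrier → Carrier → FPS
  eqSer q z u n = (u ^ (n C 2)) * (z ^ n) * inv (qfact q n)

  EqSer : Carrier → Carrier → FPS
  EqSer q z = eqSer q z q

  ASer : Carrier → (ℕ → Carrier) → FPS
  ASer q a n = a n * inv (qfact q n)

  P : Carrier → (ℕ → Carrier) → Carrier → Carrier → ℕ → Carrier
  P q a x u n = qfact q n * (ASer q a ⊛ eqSer q x u) n

  Q : Carrier → (ℕ → Carrier) → Carrier → Carrier → Carrier → Carrier → ℕ → Carrier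
  Q q a x y z u n = Σ≤ n (λ k → qbinom q n k * P q a x u k * (y ^ k) * (z ^ (n ∸ k)))

  linSer : Carrier → FPS
  linSer a zero          = 1#
  linSer a (suc zero)    = a
  linSer a (suc (suc _)) = 0#

  -- (-(1-q) z t ; q)_k = Π_{j<k} (1 + q^j (1-q) z t), a polynomial in t
  pochSer : Carrier → Carrier → ℕ → FPS
  pochSer q z zero    = monomial 1# 0
  pochSer q z (suc k) = pochSer q z k ⊛ linSer ((q ^ k) * (1# - q) * z)

  LHS : Carrier → (ℕ → Carrier) → Carrier → Carrier → Carrier → Carrier → FPS
  LHS q a x y z u n = (q ^ (n C 2)) * Q q a x y z u n * inv (qfact q n)

  term : Carrier → (ℕ → Carrier) → Carrier → Carrier → Carrier → Carrier → ℕ → FPS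
  term q a x y z u k =
    monomial ((q ^ (k C 2)) * P q a x u k * inv (qfact q k) * (y ^ k)) k ⊛ invFPS (pochSer q z k)

  -- Σ_k term_k : term_k has order ≥ k, so the coefficient of t^n only involves k ≤ n
  sumTerms : Carrier → (ℕ → Carrier) → Carrier → Carrier → Carrier → Carrier → FPS
  sumTerms q a x y z u n = Σ≤ n (λ k → term q a x y z u k n)

  RHS : Carrier → (ℕ → Carrier) → Carrier → Carrier → Carrier → Carrier → FPS
  RHS q a x y z u = EqSer q z ⊛ sumTerms q a x y z u

{-# OPTIONS --safe #-}
-- The q-exponential satisfies E_q(w t) = (1 + (1-q) w t) E_q(q w t); iterating,
-- (-(1-q) z t; q)_k E_q(q^k z t) = E_q(z t), so E_q(z t) times the k-th summand on the right
-- is c_k t^k E_q(q^k z t) with c_k = q^(k choose 2) P_k y^k / [k]_q!. Its coefficient of t^n is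
-- Σ_k c_k q^((n-k) choose 2) (q^k z)^(n-k) / [n-k]_q!, and the left side becomes the same sum
-- after expanding the Gaussian binomials in Q_n and splitting
-- (n choose 2) = (k choose 2) + ((n-k) choose 2) + k (n-k).
module Submission where

open import Defs
open import Level using (Level)
open import Data.Nat using (ℕ; _≤_)
open import Relation.Nullary using (¬_)
open import Algebra.Bundles using (CommutativeRing)

open import Function using (_∘_; flip)
open import Data.Bool using (true; false)
open import Data.Sum using (inj₁; inj₂)
open import Data.Nat as ℕ using (zero; suc; _∸_; _≤ᵇ_; _<ᵇ_; z≤n; s≤s)
open import Data.Nat.Properties
  using (≤-refl; ≤-antisym; m≤n⇒m≤1+n; m≤n⇒m<n∨m≡n; <⇒≢; n≮n; n∸n≡0; m∸n≤m; m∸[m∸n]≡n;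
         m+[n∸m]≡n; +-∸-assoc; ∸-+-assoc; ≤ᵇ-reflects-≤; <ᵇ-reflects-<)
open import Data.Nat.Combinatorics using (_C_; nC1≡n; nCk+nC[k+1]≡[n+1]C[k+1])
open import Relation.Binary.Bundles using (Setoid)
open import Relation.Binary.Structures using (IsEquivalence)
open import Relation.Binary.PropositionalEquality as ≡ using (_≡_; _≢_)
open import Relation.Nullary using (contradiction)
open import Relation.Nullary.Reflects using (ofʸ; ofⁿ)
import Relation.Binary.Reasoning.Setoid as SetoidReasoning

module _ where
  open import Data.Nat using (_+_; _*_)
  open import Data.Nat.Properties using (+-comm; +-identityʳ)
  open import Data.Nat.Tactic.RingSolver using (solve-∀)
  open ≡.≡-Reasoning

  suc-C2 : ∀ n → suc n C 2 ≡ n C 2 + n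
  suc-C2 n = begin
    suc n C 2      ≡⟨ nCk+nC[k+1]≡[n+1]C[k+1] n 1 ⟨
    n C 1 + n C 2  ≡⟨ ≡.cong (_+ n C 2) (nC1≡n n) ⟩
    n + n C 2      ≡⟨ +-comm n (n C 2) ⟩
    n C 2 + n      ∎

  +-C2 : ∀ m n → (m + n) C 2 ≡ m C 2 + n C 2 + m * n
  +-C2 zero    n = ≡.sym (+-identityʳ (n C 2))
  +-C2 (suc m) n = begin
    suc (m + n) C 2                  ≡⟨ suc-C2 (m + n) ⟩
    (m + n) C 2 + (m + n)            ≡⟨ ≡.cong (_+ (m + n)) (+-C2 m n) ⟩
    m C 2 + n C 2 + m * n + (m + n)  ≡⟨ rearrange (m C 2) (n C 2) m n ⟩
    m C 2 + m + n C 2 + (n + m * n)  ≡⟨ ≡.cong (λ t → t + n C 2 + suc m * n) (suc-C2 m) ⟨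
    suc m C 2 + n C 2 + suc m * n    ∎
    where
    rearrange : ∀ a b m n → a + b + m * n + (m + n) ≡ a + m + b + (n + m * n)
    rearrange = solve-∀

  [m∸n]∸o≡[m∸o]∸n : ∀ m n o → m ∸ n ∸ o ≡ m ∸ o ∸ n
  [m∸n]∸o≡[m∸o]∸n m n o = begin
    m ∸ n ∸ o      ≡⟨ ∸-+-assoc m n o ⟩
    m ∸ (n + o)    ≡⟨ ≡.cong (m ∸_) (+-comm n o) ⟩
    m ∸ (o + n)    ≡⟨ ∸-+-assoc m o n ⟨
    m ∸ o ∸ n      ∎

module _ {c ℓ : Level} (R : CommutativeRing c ℓ) where
  open CommutativeRing R hiding (zero)
  open import Algebra.Bundles using (Semiring)
  open import Algebra.Definitions.RawSemiring (Semiring.rawSemiring semiring) using (_^_)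
  open import Algebra.Properties.CommutativeSemiring.Exp commutativeSemiring
    using (^-homo-*; ^-assocʳ)
  open import Algebra.Properties.CommutativeSemigroup *-commutativeSemigroup using (xy∙z≈y∙xz)
  module ≈-Reasoning = SetoidReasoning setoid

  ^-C2-suc : ∀ x m → x ^ (suc m C 2) ≈ x ^ (m C 2) * x ^ m
  ^-C2-suc x m = trans (reflexive (≡.cong (x ^_) (suc-C2 m))) (^-homo-* x (m C 2) m)

  ^-C2-+ : ∀ x k m → x ^ ((k ℕ.+ m) C 2) ≈ x ^ (k C 2) * x ^ (m C 2) * (x ^ k) ^ m
  ^-C2-+ x k m = begin
    x ^ ((k ℕ.+ m) C 2)                        ≡⟨ ≡.cong (x ^_) (+-C2 k m) ⟩
    x ^ (k C 2 ℕ.+ m C 2 ℕ.+ k ℕ.* m)          ≈⟨ ^-homo-* x (k C 2 ℕ.+ m C 2) (k ℕ.* m) ⟩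
    x ^ (k C 2 ℕ.+ m C 2) * x ^ (k ℕ.* m)      ≈⟨ *-cong (^-homo-* x (k C 2) (m C 2))
                                                             (sym (^-assocʳ x k m)) ⟩
    x ^ (k C 2) * x ^ (m C 2) * (x ^ k) ^ m    ∎
    where open ≈-Reasoning

  inverse-unique : ∀ {x y y′} → x * y ≈ 1# → x * y′ ≈ 1# → y ≈ y′
  inverse-unique {x} {y} {y′} xy≈1 xy′≈1 = begin
    y               ≈⟨ *-identityˡ y ⟨
    1# * y          ≈⟨ *-congʳ xy′≈1 ⟨
    (x * y′) * y    ≈⟨ xy∙z≈y∙xz x y′ y ⟩
    y′ * (x * y)    ≈⟨ *-congˡ xy≈1 ⟩
    y′ * 1#         ≈⟨ *-identityʳ y′ ⟩
    y′              ∎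
    where open ≈-Reasoning

  module FiniteSums (inv : Carrier → Carrier) where
    open Series R inv using (Σ≤; Σ<)
    open ≈-Reasoning
    open import Algebra.Properties.CommutativeSemigroup +-commutativeSemigroup using (interchange)

    Σ≤-cong : ∀ n {f g : ℕ → Carrier} → (∀ {k} → k ≤ n → f k ≈ g k) → Σ≤ n f ≈ Σ≤ n g
    Σ≤-cong zero    f≈g = f≈g z≤n
    Σ≤-cong (suc n) f≈g = +-cong (Σ≤-cong n (f≈g ∘ m≤n⇒m≤1+n)) (f≈g ≤-refl)

    Σ≤-cong′ : ∀ n {f g : ℕ → Carrier} → (∀ k → f k ≈ g k) → Σ≤ n f ≈ Σ≤ n g
    Σ≤-cong′ n f≈g = Σ≤-cong n (λ {k} _ → f≈g k)

    Σ≤-distrib-+ : ∀ n (f g : ℕ → Carrier) → Σ≤ n (λ k → f k + g k) ≈ Σ≤ n f + Σ≤ n g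
    Σ≤-distrib-+ zero    f g = refl
    Σ≤-distrib-+ (suc n) f g = trans (+-congʳ (Σ≤-distrib-+ n f g)) (interchange _ _ _ _)

    *-distribˡ-Σ≤ : ∀ n a (f : ℕ → Carrier) → a * Σ≤ n f ≈ Σ≤ n (λ k → a * f k)
    *-distribˡ-Σ≤ zero    a f = refl
    *-distribˡ-Σ≤ (suc n) a f = trans (distribˡ a _ _) (+-congʳ (*-distribˡ-Σ≤ n a f))

    *-distribʳ-Σ≤ : ∀ n a (f : ℕ → Carrier) → Σ≤ n f * a ≈ Σ≤ n (λ k → f k * a)
    *-distribʳ-Σ≤ zero    a f = refl
    *-distribʳ-Σ≤ (suc n) a f = trans (distribʳ a _ _) (+-congʳ (*-distribʳ-Σ≤ n a f))

    Σ<-suc : ∀ n (f : ℕ → Carrier) → Σ< (suc n) f ≈ Σ≤ n f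
    Σ<-suc zero    f = +-identityˡ _
    Σ<-suc (suc n) f = +-congʳ (Σ<-suc n f)

    Σ≤-suc : ∀ n (f : ℕ → Carrier) → Σ≤ (suc n) f ≈ f 0 + Σ≤ n (f ∘ suc)
    Σ≤-suc zero    f = refl
    Σ≤-suc (suc n) f = trans (+-congʳ (Σ≤-suc n f)) (+-assoc _ _ _)

    Σ≤-reverse : ∀ n (f : ℕ → Carrier) → Σ≤ n f ≈ Σ≤ n (λ k → f (n ∸ k))
    Σ≤-reverse zero    f = refl
    Σ≤-reverse (suc n) f = begin
      Σ≤ n f + f (suc n)                    ≈⟨ +-congʳ (Σ≤-reverse n f) ⟩
      Σ≤ n (λ k → f (n ∸ k)) + f (suc n)    ≈⟨ +-comm _ _ ⟩
      f (suc n) + Σ≤ n (λ k → f (n ∸ k))    ≈⟨ Σ≤-suc n (λ k → f (suc n ∸ k)) ⟨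
      Σ≤ (suc n) (λ k → f (suc n ∸ k))      ∎

    Σ≤-zero : ∀ n {f : ℕ → Carrier} → (∀ {k} → k ≤ n → f k ≈ 0#) → Σ≤ n f ≈ 0#
    Σ≤-zero zero    f≈0 = f≈0 z≤n
    Σ≤-zero (suc n) f≈0 = trans (+-cong (Σ≤-zero n (f≈0 ∘ m≤n⇒m≤1+n)) (f≈0 ≤-refl)) (+-identityʳ 0#)

    Σ≤-single : ∀ {n i} (f : ℕ → Carrier) → i ≤ n → (∀ {k} → k ≤ n → k ≢ i → f k ≈ 0#) →
                Σ≤ n f ≈ f i
    Σ≤-single {zero}  f z≤n    _   = refl
    Σ≤-single {suc n} f i≤1+n f≈0 with m≤n⇒m<n∨m≡n i≤1+n
    ... | inj₂ ≡.refl =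
      trans (+-congʳ (Σ≤-zero n (λ k≤n → f≈0 (m≤n⇒m≤1+n k≤n) (<⇒≢ (s≤s k≤n))))) (+-identityˡ _)
    ... | inj₁ (s≤s i≤n) =
      trans (+-cong (Σ≤-single f i≤n (f≈0 ∘ m≤n⇒m≤1+n)) (f≈0 ≤-refl (<⇒≢ (s≤s i≤n) ∘ ≡.sym)))
            (+-identityʳ _)

    Σ△ : ℕ → (ℕ → ℕ → Carrier) → Carrier
    Σ△ n g = Σ≤ n (λ i → Σ≤ (n ∸ i) (g i))

    Σ△-suc : ∀ n g → Σ△ (suc n) g ≈ Σ△ n g + Σ≤ (suc n) (λ i → g i (suc n ∸ i))
    Σ△-suc n g = begin
      Σ≤ n (λ i → Σ≤ (suc n ∸ i) (g i)) + Σ≤ (n ∸ n) (g (suc n))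
        ≈⟨ +-cong (Σ≤-cong n (λ i≤n → unfold-suc (+-∸-assoc 1 i≤n))) (unfold-zero (n∸n≡0 n)) ⟩
      Σ≤ n (λ i → Σ≤ (n ∸ i) (g i) + g i (suc n ∸ i)) + g (suc n) (n ∸ n)
        ≈⟨ +-congʳ (Σ≤-distrib-+ n _ _) ⟩
      Σ△ n g + Σ≤ n (λ i → g i (suc n ∸ i)) + g (suc n) (n ∸ n)
        ≈⟨ +-assoc _ _ _ ⟩
      Σ△ n g + Σ≤ (suc n) (λ i → g i (suc n ∸ i))
        ∎
      where
      unfold-suc : ∀ {m m′} {f : ℕ → Carrier} → m ≡ suc m′ → Σ≤ m f ≈ Σ≤ m′ f + f m
      unfold-suc ≡.refl = refl
      unfold-zero : ∀ {m} {f : ℕ → Carrier} → m ≡ 0 → Σ≤ m f ≈ f m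
      unfold-zero ≡.refl = refl

    Σ△-swap : ∀ n g → Σ△ n g ≈ Σ△ n (flip g)
    Σ△-swap zero    g = refl
    Σ△-swap (suc n) g = begin
      Σ△ (suc n) g                                        ≈⟨ Σ△-suc n g ⟩
      Σ△ n g + Σ≤ (suc n) (λ i → g i (suc n ∸ i))         ≈⟨ +-cong (Σ△-swap n g) antidiagonal ⟩
      Σ△ n (flip g) + Σ≤ (suc n) (λ j → g (suc n ∸ j) j)  ≈⟨ Σ△-suc n (flip g) ⟨
      Σ△ (suc n) (flip g)                                 ∎
      where
      antidiagonal : Σ≤ (suc n) (λ i → g i (suc n ∸ i)) ≈ Σ≤ (suc n) (λ j → g (suc n ∸ j) j)
      antidiagonal = trans (Σ≤-reverse (suc n) _)
        (Σ≤-cong (suc n) (λ j≤ → reflexive (≡.cong (g _) (m∸[m∸n]≡n j≤))))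

  module PowerSeries (inv : Carrier → Carrier) where
    open Series R inv
    open FiniteSums inv
    open import Algebra.Properties.Ring ring using (-‿distribʳ-*)
    open import Algebra.Properties.CommutativeSemigroup *-commutativeSemigroup using (x∙yz≈y∙xz)

    infix 4 _≋_
    _≋_ : FPS → FPS → Set ℓ
    f ≋ g = ∀ n → f n ≈ g n

    ≋-isEquivalence : IsEquivalence _≋_
    ≋-isEquivalence = record
      { refl  = λ _ → refl
      ; sym   = λ f≋g n → sym (f≋g n)
      ; trans = λ f≋g g≋h n → trans (f≋g n) (g≋h n)
      }

    ≋-setoid : Setoid c ℓ
    ≋-setoid = record { isEquivalence = ≋-isEquivalence }

    module ≋-Reasoning = SetoidReasoning ≋-setoid

    ⊛-cong : ∀ {f f′ g g′} → f ≋ f′ → g ≋ g′ → f ⊛ g ≋ f′ ⊛ g′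
    ⊛-cong f≋f′ g≋g′ n = Σ≤-cong′ n (λ k → *-cong (f≋f′ k) (g≋g′ (n ∸ k)))

    ⊛-congˡ : ∀ f {g g′} → g ≋ g′ → f ⊛ g ≋ f ⊛ g′
    ⊛-congˡ f = ⊛-cong {f} (λ _ → refl)

    ⊛-congʳ : ∀ g {f f′} → f ≋ f′ → f ⊛ g ≋ f′ ⊛ g
    ⊛-congʳ g f≋f′ = ⊛-cong {g = g} f≋f′ (λ _ → refl)

    ⊛-comm : ∀ f g → f ⊛ g ≋ g ⊛ f
    ⊛-comm f g n = trans (Σ≤-reverse n _) (Σ≤-cong n (λ k≤n →
      trans (*-comm _ _) (*-congʳ (reflexive (≡.cong g (m∸[m∸n]≡n k≤n))))))

    -- Σ_k c_k t^k G_k(t); note that f ⊛ g is shiftedSum f (λ _ → g) by definition.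
    shiftedSum : (ℕ → Carrier) → (ℕ → FPS) → FPS
    shiftedSum c G n = Σ≤ n (λ k → c k * G k (n ∸ k))

    shiftedSum-cong : ∀ c {G H} → (∀ k → G k ≋ H k) → shiftedSum c G ≋ shiftedSum c H
    shiftedSum-cong c G≋H n = Σ≤-cong′ n (λ k → *-congˡ (G≋H k (n ∸ k)))

    ⊛-shiftedSum : ∀ f c G → f ⊛ shiftedSum c G ≋ shiftedSum c (λ k → f ⊛ G k)
    ⊛-shiftedSum f c G n = begin
      Σ≤ n (λ j → f j * Σ≤ (n ∸ j) (λ k → c k * G k (n ∸ j ∸ k)))
        ≈⟨ Σ≤-cong′ n (λ j → *-distribˡ-Σ≤ (n ∸ j) (f j) _) ⟩
      Σ△ n (λ j k → f j * (c k * G k (n ∸ j ∸ k)))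
        ≈⟨ Σ△-swap n _ ⟩
      Σ△ n (λ k j → f j * (c k * G k (n ∸ j ∸ k)))
        ≈⟨ Σ≤-cong′ n (λ k → Σ≤-cong′ (n ∸ k) (λ j → trans (x∙yz≈y∙xz _ _ _)
             (*-congˡ (*-congˡ (reflexive (≡.cong (G k) ([m∸n]∸o≡[m∸o]∸n n j k))))))) ⟩
      Σ≤ n (λ k → Σ≤ (n ∸ k) (λ j → c k * (f j * G k (n ∸ k ∸ j))))
        ≈⟨ Σ≤-cong′ n (λ k → *-distribˡ-Σ≤ (n ∸ k) (c k) _) ⟨
      shiftedSum c (λ k → f ⊛ G k) n
        ∎
      where open ≈-Reasoning

    ⊛-assoc : ∀ f g h → (f ⊛ g) ⊛ h ≋ f ⊛ (g ⊛ h)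
    ⊛-assoc f g h = begin
      (f ⊛ g) ⊛ h  ≈⟨ ⊛-comm (f ⊛ g) h ⟩
      h ⊛ (f ⊛ g)  ≈⟨ ⊛-shiftedSum h f (λ _ → g) ⟩
      f ⊛ (h ⊛ g)  ≈⟨ ⊛-congˡ f (⊛-comm h g) ⟩
      f ⊛ (g ⊛ h)  ∎
      where open ≋-Reasoning

    monomial-≡ : ∀ a k → monomial a k k ≈ a
    monomial-≡ a k with k ≤ᵇ k | ≤ᵇ-reflects-≤ k k
    ... | true  | _       = refl
    ... | false | ofⁿ k≰k = contradiction ≤-refl k≰k

    monomial-≢ : ∀ a {k m} → m ≢ k → monomial a k m ≈ 0#
    monomial-≢ a {k} {m} m≢k with k ≤ᵇ m | ≤ᵇ-reflects-≤ k m | m ≤ᵇ k | ≤ᵇ-reflects-≤ m k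
    ... | true  | ofʸ k≤m | true  | ofʸ m≤k = contradiction (≤-antisym m≤k k≤m) m≢k
    ... | true  | _       | false | _       = refl
    ... | false | _       | _     | _       = refl

    monomial-⊛ : ∀ a {k m} g → k ≤ m → (monomial a k ⊛ g) m ≈ a * g (m ∸ k)
    monomial-⊛ a {k} g k≤m =
      trans (Σ≤-single _ k≤m (λ _ i≢k → trans (*-congʳ (monomial-≢ a i≢k)) (zeroˡ _)))
            (*-congʳ (monomial-≡ a k))

    ⊛-identityˡ : ∀ f → monomial 1# 0 ⊛ f ≋ f
    ⊛-identityˡ f m = trans (monomial-⊛ 1# f z≤n) (*-identityˡ _)

    linSer-cong : ∀ {a b} → a ≈ b → linSer a ≋ linSer b
    linSer-cong a≈b zero          = refl
    linSer-cong a≈b (suc zero)    = a≈b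
    linSer-cong a≈b (suc (suc _)) = refl

    linSer-⊛-suc : ∀ a g m → (linSer a ⊛ g) (suc m) ≈ g (suc m) + a * g m
    linSer-⊛-suc a g m = trans (Σ≤-suc m _) (+-cong (*-identityˡ _) (Σ≤-single _ z≤n vanish))
      where
      vanish : ∀ {k} → k ≤ m → k ≢ 0 → linSer a (suc k) * g (m ∸ k) ≈ 0#
      vanish {zero}  _ 0≢0 = contradiction ≡.refl 0≢0
      vanish {suc k} _ _   = zeroˡ _

    approx-stable : ∀ f {m n} → m ≤ n → approx f n m ≡ invFPS f m
    approx-stable f {n = zero}  z≤n   = ≡.refl
    approx-stable f {m} {suc n} m≤1+n with m≤n⇒m<n∨m≡n m≤1+n
    ... | inj₂ ≡.refl      = ≡.refl
    ... | inj₁ (s≤s m≤n) with m ≤ᵇ n | ≤ᵇ-reflects-≤ m n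
    ...   | true  | _       = approx-stable f m≤n
    ...   | false | ofⁿ m≰n = contradiction m≤n m≰n

    invFPS-suc : ∀ f n →
      invFPS f (suc n) ≈ - (inv (f 0) * Σ≤ n (λ k → f (suc k) * invFPS f (n ∸ k)))
    invFPS-suc f n with n <ᵇ n | <ᵇ-reflects-< n n
    ... | true  | ofʸ n<n = contradiction n<n (n≮n n)
    ... | false | _       = -‿cong (*-congˡ (trans (Σ<-suc n _) (Σ≤-cong′ n (λ k →
      *-congˡ (reflexive (approx-stable f (m∸n≤m n k)))))))

    ⊛-invFPS : ∀ f → f 0 * inv (f 0) ≈ 1# → f ⊛ invFPS f ≋ monomial 1# 0
    ⊛-invFPS f f₀-invertible zero    = f₀-invertible
    ⊛-invFPS f f₀-invertible (suc n) = begin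
      (f ⊛ invFPS f) (suc n)          ≈⟨ Σ≤-suc n _ ⟩
      f 0 * invFPS f (suc n) + S      ≈⟨ +-congʳ (*-congˡ (invFPS-suc f n)) ⟩
      f 0 * - (inv (f 0) * S) + S     ≈⟨ +-congʳ (-‿distribʳ-* _ _) ⟨
      - (f 0 * (inv (f 0) * S)) + S   ≈⟨ +-congʳ (-‿cong (trans (sym (*-assoc _ _ _)) cancel)) ⟩
      - S + S                         ≈⟨ -‿inverseˡ S ⟩
      0#                              ∎
      where
      open ≈-Reasoning
      S = Σ≤ n (λ k → f (suc k) * invFPS f (n ∸ k))
      cancel : (f 0 * inv (f 0)) * S ≈ S
      cancel = trans (*-congʳ f₀-invertible) (*-identityˡ S)

    ⊛-invFPS-cancel : ∀ f g → f 0 * inv (f 0) ≈ 1# → (f ⊛ g) ⊛ invFPS f ≋ g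
    ⊛-invFPS-cancel f g f₀-invertible = begin
      (f ⊛ g) ⊛ invFPS f          ≈⟨ ⊛-congʳ (invFPS f) (⊛-comm f g) ⟩
      (g ⊛ f) ⊛ invFPS f          ≈⟨ ⊛-assoc g f (invFPS f) ⟩
      g ⊛ (f ⊛ invFPS f)          ≈⟨ ⊛-congˡ g (⊛-invFPS f f₀-invertible) ⟩
      g ⊛ monomial 1# 0           ≈⟨ ⊛-comm g (monomial 1# 0) ⟩
      monomial 1# 0 ⊛ g           ≈⟨ ⊛-identityˡ g ⟩
      g                           ∎
      where open ≋-Reasoning

  module Inverses (inv : Carrier → Carrier) (0≉1 : 0# ≉ 1#)
                  (*-inverseʳ : ∀ x → x ≉ 0# → x * inv x ≈ 1#) where
    open ≈-Reasoning
    open import Algebra.Properties.CommutativeSemigroup *-commutativeSemigroup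
      using (interchange)

    1≉0 : 1# ≉ 0#
    1≉0 = 0≉1 ∘ sym

    *-≉0 : ∀ {x y} → x ≉ 0# → y ≉ 0# → x * y ≉ 0#
    *-≉0 {x} {y} x≉0 y≉0 xy≈0 = x≉0 (begin
      x                  ≈⟨ *-identityʳ x ⟨
      x * 1#             ≈⟨ *-congˡ (*-inverseʳ y y≉0) ⟨
      x * (y * inv y)    ≈⟨ *-assoc x y (inv y) ⟨
      (x * y) * inv y    ≈⟨ *-congʳ xy≈0 ⟩
      0# * inv y         ≈⟨ zeroˡ (inv y) ⟩
      0#                 ∎)

    inv-* : ∀ {x y} → x ≉ 0# → y ≉ 0# → inv (x * y) ≈ inv x * inv y
    inv-* {x} {y} x≉0 y≉0 = inverse-unique (*-inverseʳ (x * y) (*-≉0 x≉0 y≉0)) (begin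
      (x * y) * (inv x * inv y)    ≈⟨ interchange x y (inv x) (inv y) ⟩
      (x * inv x) * (y * inv y)    ≈⟨ *-cong (*-inverseʳ x x≉0) (*-inverseʳ y y≉0) ⟩
      1# * 1#                      ≈⟨ *-identityˡ 1# ⟩
      1#                           ∎)

  module QExponential (inv : Carrier → Carrier) (0≉1 : 0# ≉ 1#)
                      (*-inverseʳ : ∀ x → x ≉ 0# → x * inv x ≈ 1#)
                      (q : Carrier) (q≉1 : q ≉ 1#)
                      (qint≉0 : ∀ n → 1 ≤ n → Series.qint R inv q n ≉ 0#) where
    open Series R inv
    open FiniteSums inv
    open PowerSeries inv
    open Inverses inv 0≉1 *-inverseʳ
    open import Algebra.Properties.CommutativeSemiring.Exp commutativeSemiring
      using (^-congˡ; ^-distrib-*)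
    open import Algebra.Properties.Group +-group using (x∙y⁻¹≈ε⇒x≈y; //-rightDividesˡ)
    open import Algebra.Solver.Ring.NaturalCoefficients.Default commutativeSemiring
      using (solve; _:+_; _:*_; _:=_)

    1-q≉0 : 1# - q ≉ 0#
    1-q≉0 1-q≈0 = q≉1 (sym (x∙y⁻¹≈ε⇒x≈y 1# q 1-q≈0))

    qfact≉0 : ∀ n → qfact q n ≉ 0#
    qfact≉0 zero    = 1≉0
    qfact≉0 (suc n) = *-≉0 (qfact≉0 n) (qint≉0 (suc n) (s≤s z≤n))

    inv-qfact-suc : ∀ n → inv (qfact q (suc n)) ≈ inv (qfact q n) * inv (qint q (suc n))
    inv-qfact-suc n = inv-* (qfact≉0 n) (qint≉0 (suc n) (s≤s z≤n))

    [1-qⁿ]*inv[n]≈1-q : ∀ n → 1 ≤ n → (1# - q ^ n) * inv (qint q n) ≈ 1# - q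
    [1-qⁿ]*inv[n]≈1-q n 1≤n = begin
      (1# - q ^ n) * inv [n]           ≈⟨ *-congʳ [n]*[1-q]≈1-qⁿ ⟨
      [n] * (1# - q) * inv [n]         ≈⟨ solve 3 (λ a s i → a :* s :* i := (a :* i) :* s) refl
                                            [n] (1# - q) (inv [n]) ⟩
      ([n] * inv [n]) * (1# - q)       ≈⟨ *-congʳ (*-inverseʳ [n] (qint≉0 n 1≤n)) ⟩
      1# * (1# - q)                    ≈⟨ *-identityˡ _ ⟩
      1# - q                           ∎
      where
      open ≈-Reasoning
      [n] = qint q n
      [n]*[1-q]≈1-qⁿ : [n] * (1# - q) ≈ 1# - q ^ n
      [n]*[1-q]≈1-qⁿ = trans (*-assoc _ _ _)
        (trans (*-congˡ (trans (*-comm _ _) (*-inverseʳ _ 1-q≉0))) (*-identityʳ _))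

    EqSer-cong : ∀ {w w′} → w ≈ w′ → EqSer q w ≋ EqSer q w′
    EqSer-cong w≈w′ n = *-congʳ (*-congˡ (^-congˡ n w≈w′))

    EqSer-functional : ∀ w → linSer ((1# - q) * w) ⊛ EqSer q (q * w) ≋ EqSer q w
    EqSer-functional w zero    = *-identityˡ _
    EqSer-functional w (suc m) = begin
      (linSer ((1# - q) * w) ⊛ EqSer q (q * w)) (suc m)
        ≈⟨ linSer-⊛-suc ((1# - q) * w) (EqSer q (q * w)) m ⟩
      EqSer q (q * w) (suc m) + (1# - q) * w * EqSer q (q * w) m
        ≈⟨ +-cong leading trailing ⟩
      Y * (q ^ suc m * i) + Y * ((1# - q ^ suc m) * i)
        ≈⟨ solve 4 (λ Y Q S i → Y :* (Q :* i) :+ Y :* (S :* i) := Y :* ((Q :+ S) :* i))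
             refl Y (q ^ suc m) (1# - q ^ suc m) i ⟩
      Y * ((q ^ suc m + (1# - q ^ suc m)) * i)
        ≈⟨ *-congˡ (*-congʳ (trans (+-comm _ _) (//-rightDividesˡ (q ^ suc m) 1#))) ⟩
      Y * (1# * i)
        ≈⟨ *-congˡ (*-identityˡ i) ⟩
      Y * i
        ≈⟨ target ⟨
      EqSer q w (suc m)
        ∎
      where
      open ≈-Reasoning
      A = q ^ (m C 2)
      B = q ^ m
      F = inv (qfact q m)
      i = inv (qint q (suc m))
      Y = A * B * w ^ suc m * F

      leading : EqSer q (q * w) (suc m) ≈ Y * (q ^ suc m * i)
      leading = begin
        q ^ (suc m C 2) * (q * w) ^ suc m * inv (qfact q (suc m))
          ≈⟨ *-cong (*-cong (^-C2-suc q m) (^-distrib-* q w (suc m))) (inv-qfact-suc m) ⟩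
        A * B * (q ^ suc m * w ^ suc m) * (F * i)
          ≈⟨ solve 6 (λ A B Q W F i →
                 A :* B :* (Q :* W) :* (F :* i) := A :* B :* W :* F :* (Q :* i))
               refl A B (q ^ suc m) (w ^ suc m) F i ⟩
        Y * (q ^ suc m * i)
          ∎

      trailing : (1# - q) * w * EqSer q (q * w) m ≈ Y * ((1# - q ^ suc m) * i)
      trailing = begin
        (1# - q) * w * (A * (q * w) ^ m * F)
          ≈⟨ *-cong (*-congʳ (sym ([1-qⁿ]*inv[n]≈1-q (suc m) (s≤s z≤n))))
                    (*-congʳ (*-congˡ (^-distrib-* q w m))) ⟩
        (1# - q ^ suc m) * i * w * (A * (B * w ^ m) * F)
          ≈⟨ solve 7 (λ S i w A B W F →
                 S :* i :* w :* (A :* (B :* W) :* F) := A :* B :* (w :* W) :* F :* (S :* i))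
               refl (1# - q ^ suc m) i w A B (w ^ m) F ⟩
        Y * ((1# - q ^ suc m) * i)
          ∎

      target : EqSer q w (suc m) ≈ Y * i
      target = begin
        q ^ (suc m C 2) * w ^ suc m * inv (qfact q (suc m))
          ≈⟨ *-cong (*-congʳ (^-C2-suc q m)) (inv-qfact-suc m) ⟩
        A * B * w ^ suc m * (F * i)
          ≈⟨ *-assoc _ _ _ ⟨
        Y * i
          ∎

    pochSer-⊛-EqSer : ∀ z k → pochSer q z k ⊛ EqSer q (q ^ k * z) ≋ EqSer q z
    pochSer-⊛-EqSer z zero    = begin
      monomial 1# 0 ⊛ EqSer q (1# * z)  ≈⟨ ⊛-identityˡ _ ⟩
      EqSer q (1# * z)                  ≈⟨ EqSer-cong (*-identityˡ z) ⟩
      EqSer q z                         ∎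
      where open ≋-Reasoning
    pochSer-⊛-EqSer z (suc k) = begin
      (pochSer q z k ⊛ linSer (q ^ k * (1# - q) * z)) ⊛ EqSer q (q * q ^ k * z)
        ≈⟨ ⊛-assoc (pochSer q z k) (linSer (q ^ k * (1# - q) * z)) (EqSer q (q * q ^ k * z)) ⟩
      pochSer q z k ⊛ (linSer (q ^ k * (1# - q) * z) ⊛ EqSer q (q * q ^ k * z))
        ≈⟨ ⊛-congˡ (pochSer q z k) (⊛-cong (linSer-cong reorder) (EqSer-cong (*-assoc q (q ^ k) z))) ⟩
      pochSer q z k ⊛ (linSer ((1# - q) * (q ^ k * z)) ⊛ EqSer q (q * (q ^ k * z)))
        ≈⟨ ⊛-congˡ (pochSer q z k) (EqSer-functional (q ^ k * z)) ⟩
      pochSer q z k ⊛ EqSer q (q ^ k * z)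
        ≈⟨ pochSer-⊛-EqSer z k ⟩
      EqSer q z
        ∎
      where
      open ≋-Reasoning
      reorder : q ^ k * (1# - q) * z ≈ (1# - q) * (q ^ k * z)
      reorder = solve 3 (λ Q s z → Q :* s :* z := s :* (Q :* z)) refl (q ^ k) (1# - q) z

    pochSer-constant : ∀ z k → pochSer q z k 0 ≈ 1#
    pochSer-constant z zero    = refl
    pochSer-constant z (suc k) = trans (*-identityʳ _) (pochSer-constant z k)

    EqSer-⊛-invFPS-pochSer : ∀ z k → EqSer q z ⊛ invFPS (pochSer q z k) ≋ EqSer q (q ^ k * z)
    EqSer-⊛-invFPS-pochSer z k = begin
      EqSer q z ⊛ invFPS p                     ≈⟨ ⊛-congʳ (invFPS p) (pochSer-⊛-EqSer z k) ⟨
      (p ⊛ EqSer q (q ^ k * z)) ⊛ invFPS p     ≈⟨ ⊛-invFPS-cancel p (EqSer q (q ^ k * z)) p₀-invertible ⟩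
      EqSer q (q ^ k * z)                      ∎
      where
      open ≋-Reasoning
      p = pochSer q z k
      p₀-invertible : p 0 * inv (p 0) ≈ 1#
      p₀-invertible = *-inverseʳ (p 0) (λ p₀≈0 → 1≉0 (trans (sym (pochSer-constant z k)) p₀≈0))

    module Expansion (a : ℕ → Carrier) (x y z u : Carrier) where

      coefficient : ℕ → Carrier
      coefficient k = q ^ (k C 2) * P q a x u k * inv (qfact q k) * y ^ k

      LHS-summand : ∀ {n k} → k ≤ n →
        q ^ (n C 2) * (qbinom q n k * P q a x u k * y ^ k * z ^ (n ∸ k)) * inv (qfact q n)
          ≈ coefficient k * EqSer q (q ^ k * z) (n ∸ k)
      LHS-summand {n} {k} k≤n = begin
        q ^ (n C 2) * (qbinom q n k * Pₖ * y ^ k * z ^ m) * inv [n]!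
          ≈⟨ *-congʳ (*-cong split (*-congʳ (*-congʳ (*-congʳ (*-congˡ inv-[k]![m]!))))) ⟩
        A * B * Qₖ * ([n]! * (iK * iM) * Pₖ * y ^ k * z ^ m) * inv [n]!
          ≈⟨ solve 10 (λ A B Q F iF iK iM P Y Z →
                 A :* B :* Q :* (F :* (iK :* iM) :* P :* Y :* Z) :* iF
                   := (F :* iF) :* (A :* P :* iK :* Y :* (B :* (Q :* Z) :* iM)))
               refl A B Qₖ [n]! (inv [n]!) iK iM Pₖ (y ^ k) (z ^ m) ⟩
        ([n]! * inv [n]!) * (coefficient k * (B * (Qₖ * z ^ m) * iM))
          ≈⟨ *-congʳ (*-inverseʳ [n]! (qfact≉0 n)) ⟩
        1# * (coefficient k * (B * (Qₖ * z ^ m) * iM))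
          ≈⟨ *-identityˡ _ ⟩
        coefficient k * (B * (Qₖ * z ^ m) * iM)
          ≈⟨ *-congˡ (*-congʳ (*-congˡ (^-distrib-* (q ^ k) z m))) ⟨
        coefficient k * EqSer q (q ^ k * z) m
          ∎
        where
        open ≈-Reasoning
        m = n ∸ k
        Pₖ = P q a x u k
        A = q ^ (k C 2)
        B = q ^ (m C 2)
        Qₖ = (q ^ k) ^ m
        [n]! = qfact q n
        iK = inv (qfact q k)
        iM = inv (qfact q m)
        inv-[k]![m]! : inv (qfact q k * qfact q m) ≈ iK * iM
        inv-[k]![m]! = inv-* (qfact≉0 k) (qfact≉0 m)
        split : q ^ (n C 2) ≈ A * B * Qₖ
        split = trans (reflexive (≡.cong (λ t → q ^ (t C 2)) (≡.sym (m+[n∸m]≡n k≤n)))) (^-C2-+ q k m)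

      LHS≋shiftedSum : LHS q a x y z u ≋ shiftedSum coefficient (λ k → EqSer q (q ^ k * z))
      LHS≋shiftedSum n = begin
        q ^ (n C 2) * Σ≤ n summand * inv (qfact q n)
          ≈⟨ *-congʳ (*-distribˡ-Σ≤ n _ _) ⟩
        Σ≤ n (λ k → q ^ (n C 2) * summand k) * inv (qfact q n)
          ≈⟨ *-distribʳ-Σ≤ n _ _ ⟩
        Σ≤ n (λ k → q ^ (n C 2) * summand k * inv (qfact q n))
          ≈⟨ Σ≤-cong n LHS-summand ⟩
        shiftedSum coefficient (λ k → EqSer q (q ^ k * z)) n
          ∎
        where
        open ≈-Reasoning
        summand : ℕ → Carrier
        summand k = qbinom q n k * P q a x u k * y ^ k * z ^ (n ∸ k)

      RHS≋shiftedSum : RHS q a x y z u ≋ shiftedSum coefficient (λ k → EqSer q (q ^ k * z))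
      RHS≋shiftedSum = begin
        EqSer q z ⊛ sumTerms q a x y z u
          ≈⟨ ⊛-congˡ (EqSer q z) sumTerms≋shiftedSum ⟩
        EqSer q z ⊛ shiftedSum coefficient (λ k → invFPS (pochSer q z k))
          ≈⟨ ⊛-shiftedSum (EqSer q z) coefficient (λ k → invFPS (pochSer q z k)) ⟩
        shiftedSum coefficient (λ k → EqSer q z ⊛ invFPS (pochSer q z k))
          ≈⟨ shiftedSum-cong coefficient (EqSer-⊛-invFPS-pochSer z) ⟩
        shiftedSum coefficient (λ k → EqSer q (q ^ k * z))
          ∎
        where
        open ≋-Reasoning
        sumTerms≋shiftedSum :
          sumTerms q a x y z u ≋ shiftedSum coefficient (λ k → invFPS (pochSer q z k))
        sumTerms≋shiftedSum n =
          Σ≤-cong n (λ {k} → monomial-⊛ (coefficient k) (invFPS (pochSer q z k)))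

theorem15 : {c ℓ : Level} (R : CommutativeRing c ℓ)
    (inv : CommutativeRing.Carrier R → CommutativeRing.Carrier R) →
    let open CommutativeRing R in
    ¬ (0# ≈ 1#) →
    (∀ w → ¬ (w ≈ 0#) → w * inv w ≈ 1#) →
    (q u α x y z : Carrier) (a : Carrier → ℕ → Carrier) →
    ¬ (q ≈ 1#) →
    (∀ n → 1 ≤ n → ¬ (Series.qint R inv q n ≈ 0#)) →
    ¬ (a α 0 ≈ 0#) →
    ∀ n → Series.LHS R inv q (a α) x y z u n ≈ Series.RHS R inv q (a α) x y z u n
theorem15 R inv 0≉1 *-inverseʳ q u α x y z a q≉1 qint≉0 _ n =
  trans (LHS≋shiftedSum n) (sym (RHS≋shiftedSum n))
  where
  open CommutativeRing R using (trans; sym)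
  open QExponential.Expansion R inv 0≉1 *-inverseʳ q q≉1 qint≉0 (a α) x y z u
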